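{- Let $r \ge 2$ be an even and $a \ge 3$ an odd positive integer. Let $d$, $s$ and $x$ be positive integers such that $\frac{d+s}{r+a} = x = \frac{d}{r}$, $x \ge 2$ and $d > \frac{a}{r}$. Then there exists a simple $(d,d+s)$-graph which has no $(r,r+a)$-factorization with $x$ factors.
   Context: All graphs are finite simple graphs. A $(d,d+s)$-graph is a graph all of whose vertex degrees lie in $\{d, \ldots, d+s\}$. An $(r,r+a)$-factor of $G$ is a spanning subgraph all of whose degrees lie in $\{r,\ldots,r+a\}$; an $(r,r+a)$-factorization of $G$ with $x$ factors is a decomposition of $E(G)$ into $x$ edge-disjoint $(r,r+a)$-factors. -}

module Defs where

open import Data.Nat using (ℕ; zero; suc; _+_; _≤_)
open import Data.Fin using (Fin; zero; suc; _≟_)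
open import Data.Bool using (Bool; true; false; _∧_; if_then_else_)
open import Data.Product using (Σ; _×_)
open import Relation.Nullary.Decidable using (⌊_⌋)
open import Relation.Binary.PropositionalEquality using (_≡_)

sumFin : (n : ℕ) → (Fin n → ℕ) → ℕ
sumFin zero    f = 0
sumFin (suc n) f = f zero + sumFin n (λ i → f (suc i))

countFin : (n : ℕ) → (Fin n → Bool) → ℕ
countFin n P = sumFin n (λ i → if P i then 1 else 0)

record SimpleGraph (n : ℕ) : Set where
  field
    adj     : Fin n → Fin n → Bool
    sym     : ∀ i j → adj i j ≡ adj j i
    irrefl  : ∀ i → adj i i ≡ false

open SimpleGraph public

degree : {n : ℕ} → SimpleGraph n → Fin n → ℕ
degree {n} G v = countFin n (adj G v)

IsRangeGraph : {n : ℕ} → SimpleGraph n → ℕ → ℕ → Set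
IsRangeGraph {n} G d s = ∀ v → d ≤ degree G v × degree G v ≤ d + s

-- A decomposition of E(G) into x edge-disjoint spanning subgraphs F_0,…,F_{x-1}:
-- each edge {u,v} is assigned to exactly one factor, given by col u v (= col v u).
record EdgeDecomposition {n : ℕ} (G : SimpleGraph n) (x : ℕ) : Set where
  field
    col    : Fin n → Fin n → Fin x
    colSym : ∀ u v → adj G u v ≡ true → col u v ≡ col v u

open EdgeDecomposition public

factorDegree : {n x : ℕ} {G : SimpleGraph n} → EdgeDecomposition G x → Fin x → Fin n → ℕ
factorDegree {n} {x} {G} D k v = countFin n (λ u → adj G v u ∧ ⌊ col D v u ≟ k ⌋)

record RangeFactorization {n : ℕ} (G : SimpleGraph n) (r a x : ℕ) : Set where
  field
    decomp  : EdgeDecomposition G x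
    degOK   : ∀ k v → r ≤ factorDegree decomp k v × factorDegree decomp k v ≤ r + a

module Submission where

-- Take m = ⌊x(r+a)/2⌋ disjoint copies of K_{d+1} minus an edge and join a new vertex w to both ends
-- of every missing edge. Then w has degree 2m ∈ [d, d+s] and every other vertex has degree d = xr.
-- In an (r,r+a)-factorization with x factors every vertex other than w has degree exactly r in each
-- factor, while w, of degree at least x(r+a) − 1 > x(r+a) − x, has degree r + a in some factor F.
-- The degree sum of F is then r + a plus a multiple of r, which is odd.

open import Defs
open import Data.Nat using (ℕ; zero; suc; _+_; _*_; _≤_; _<_; z≤n; s≤s; ⌊_/2⌋)
open import Data.Nat.Properties
  using ( +-assoc; +-comm; +-identityʳ; *-comm; *-identityʳ; *-zeroʳ; +-mono-≤; +-monoʳ-≤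
        ; +-monoʳ-<; +-cancelʳ-≤; +-cancelˡ-≡; ≤-refl; ≤-trans; ≤-antisym; ≤-<-trans
        ; ≤⇒≯; ≤∧≢⇒<; m≤m+n; m<m+n; +-commutativeSemigroup)
import Data.Nat.Properties as ℕ
open import Data.Nat.Divisibility using (_∣_; divides; ∣m+n∣m⇒∣n; ∣n⇒∣m*n; ∣m∣n⇒∣m+n)
open import Algebra.Properties.CommutativeSemigroup +-commutativeSemigroup using (interchange)
open import Data.Fin using (Fin; zero; suc; combine; remQuot; _↑ˡ_; _↑ʳ_; _≟_)
open import Data.Fin.Properties using (remQuot-combine; any?)
open import Data.Bool using (Bool; true; false; _∧_; not; if_then_else_)
open import Data.Bool.Properties using (∧-zeroʳ)
open import Data.Product using (Σ; _×_; _,_; proj₁; proj₂; ∃)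
open import Relation.Nullary using (¬_; yes; no; contradiction)
open import Relation.Nullary.Decidable using (⌊_⌋)
open import Relation.Binary.PropositionalEquality
  using (_≡_; refl; cong; cong₂; trans; subst; ≡-≟-identity; module ≡-Reasoning)
  renaming (sym to ≡-sym)

⌊suc≟suc⌋ : ∀ {n} (i j : Fin n) → ⌊ suc i ≟ suc j ⌋ ≡ ⌊ i ≟ j ⌋
⌊suc≟suc⌋ i j with i ≟ j
... | yes _ = refl
... | no  _ = refl

⌊≟⌋-sym : ∀ {n} (i j : Fin n) → ⌊ i ≟ j ⌋ ≡ ⌊ j ≟ i ⌋
⌊≟⌋-sym i j with i ≟ j | j ≟ i
... | yes _   | yes _   = refl
... | no  _   | no  _   = refl
... | yes i≡j | no  j≢i = contradiction (≡-sym i≡j) j≢i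
... | no  i≢j | yes j≡i = contradiction (≡-sym j≡i) i≢j

⌊≟⌋-refl : ∀ {n} (i : Fin n) → ⌊ i ≟ i ⌋ ≡ true
⌊≟⌋-refl i = cong ⌊_⌋ (≡-≟-identity _≟_ refl)

sumFin-cong : ∀ n {f g : Fin n → ℕ} → (∀ i → f i ≡ g i) → sumFin n f ≡ sumFin n g
sumFin-cong zero    f≡g = refl
sumFin-cong (suc n) f≡g = cong₂ _+_ (f≡g zero) (sumFin-cong n (λ i → f≡g (suc i)))

sumFin-const : ∀ n c → sumFin n (λ _ → c) ≡ n * c
sumFin-const zero    c = refl
sumFin-const (suc n) c = cong (c +_) (sumFin-const n c)

sumFin-zero : ∀ n → sumFin n (λ _ → 0) ≡ 0
sumFin-zero n = trans (sumFin-const n 0) (*-zeroʳ n)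

sumFin-one : ∀ n → sumFin n (λ _ → 1) ≡ n
sumFin-one n = trans (sumFin-const n 1) (*-identityʳ n)

sumFin-+ : ∀ n (f g : Fin n → ℕ) → sumFin n (λ i → f i + g i) ≡ sumFin n f + sumFin n g
sumFin-+ zero    f g = refl
sumFin-+ (suc n) f g =
  trans (cong (f zero + g zero +_) (sumFin-+ n (λ i → f (suc i)) (λ i → g (suc i))))
        (interchange (f zero) (g zero) _ _)

sumFin-mono : ∀ n {f g : Fin n → ℕ} → (∀ i → f i ≤ g i) → sumFin n f ≤ sumFin n g
sumFin-mono zero    f≤g = z≤n
sumFin-mono (suc n) f≤g = +-mono-≤ (f≤g zero) (sumFin-mono n (λ i → f≤g (suc i)))

sumFin-swap : ∀ m n (h : Fin m → Fin n → ℕ) →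
  sumFin m (λ i → sumFin n (h i)) ≡ sumFin n (λ j → sumFin m (λ i → h i j))
sumFin-swap zero    n h = ≡-sym (sumFin-zero n)
sumFin-swap (suc m) n h =
  trans (cong (sumFin n (h zero) +_) (sumFin-swap m n (λ i → h (suc i))))
        (≡-sym (sumFin-+ n (h zero) (λ j → sumFin m (λ i → h (suc i) j))))

sumFin-++ : ∀ m n (f : Fin (m + n) → ℕ) →
  sumFin (m + n) f ≡ sumFin m (λ i → f (i ↑ˡ n)) + sumFin n (λ j → f (m ↑ʳ j))
sumFin-++ zero    n f = refl
sumFin-++ (suc m) n f =
  trans (cong (f zero +_) (sumFin-++ m n (λ i → f (suc i)))) (≡-sym (+-assoc (f zero) _ _))

sumFin-combine : ∀ m n (f : Fin (m * n) → ℕ) →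
  sumFin (m * n) f ≡ sumFin m (λ i → sumFin n (λ j → f (combine i j)))
sumFin-combine zero    n f = refl
sumFin-combine (suc m) n f =
  trans (sumFin-++ n (m * n) f)
        (cong (sumFin n (λ j → f (j ↑ˡ (m * n))) +_) (sumFin-combine m n (λ v → f (n ↑ʳ v))))

sumFin-remQuot : ∀ m n (f : Fin m × Fin n → ℕ) →
  sumFin (m * n) (λ v → f (remQuot {m} n v)) ≡ sumFin m (λ i → sumFin n (λ j → f (i , j)))
sumFin-remQuot m n f =
  trans (sumFin-combine m n _)
        (sumFin-cong m (λ i → sumFin-cong n (λ j → cong f (remQuot-combine i j))))

sumFin-indicator : ∀ {n} (i : Fin n) c → sumFin n (λ j → if ⌊ i ≟ j ⌋ then c else 0) ≡ c
sumFin-indicator {suc n} zero    c = trans (cong (c +_) (sumFin-zero n)) (+-identityʳ c)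
sumFin-indicator {suc n} (suc i) c =
  trans (sumFin-cong n (λ j → cong (λ b → if b then c else 0) (⌊suc≟suc⌋ i j)))
        (sumFin-indicator i c)

countFin-∧ˡ : ∀ n (b : Bool) (P : Fin n → Bool) →
  countFin n (λ i → b ∧ P i) ≡ (if b then countFin n P else 0)
countFin-∧ˡ n false P = sumFin-zero n
countFin-∧ˡ n true  P = refl

countFin-≟ : ∀ {n} (i : Fin n) → countFin n (λ j → ⌊ i ≟ j ⌋) ≡ 1
countFin-≟ i = sumFin-indicator i 1

countFin-≢ : ∀ {n} (i : Fin n) → suc (countFin n (λ j → not ⌊ i ≟ j ⌋)) ≡ n
countFin-≢ {suc n} zero    = cong suc (sumFin-one n)
countFin-≢ {suc n} (suc i) =
  cong suc (trans (cong suc (sumFin-cong n (λ j → cong (λ b → if not b then 1 else 0) (⌊suc≟suc⌋ i j))))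
                  (countFin-≢ i))

double-sum-even : ∀ n (f : Fin n → Fin n → ℕ) → (∀ u v → f u v ≡ f v u) → (∀ u → f u u ≡ 0) →
  2 ∣ sumFin n (λ u → sumFin n (f u))
double-sum-even zero    f f-sym f-diag = divides 0 refl
double-sum-even (suc n) f f-sym f-diag =
  subst (2 ∣_) (≡-sym split) (∣m∣n⇒∣m+n (divides A A+A≡A*2) rest-even)
  where
  A = sumFin n (λ v → f zero (suc v))
  R = sumFin n (λ u → sumFin n (λ v → f (suc u) (suc v)))
  A+A≡A*2 : A + A ≡ A * 2
  A+A≡A*2 = trans (cong (A +_) (≡-sym (+-identityʳ A))) (*-comm 2 A)
  rest-even : 2 ∣ R
  rest-even = double-sum-even n (λ u v → f (suc u) (suc v))
    (λ u v → f-sym (suc u) (suc v)) (λ u → f-diag (suc u))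
  split : sumFin (suc n) (λ u → sumFin (suc n) (f u)) ≡ (A + A) + R
  split = begin
    (f zero zero + A) + sumFin n (λ u → f (suc u) zero + sumFin n (λ v → f (suc u) (suc v)))
      ≡⟨ cong₂ _+_ (cong (_+ A) (f-diag zero)) (sumFin-+ n (λ u → f (suc u) zero) _) ⟩
    A + (sumFin n (λ u → f (suc u) zero) + R)
      ≡⟨ cong (λ z → A + (z + R)) (sumFin-cong n (λ u → f-sym (suc u) zero)) ⟩
    A + (A + R)
      ≡⟨ ≡-sym (+-assoc A A R) ⟩
    (A + A) + R ∎
    where open ≡-Reasoning

degree-sum-even : ∀ {n} (G : SimpleGraph n) → 2 ∣ sumFin n (degree G)
degree-sum-even {n} G = double-sum-even n (λ u v → if adj G u v then 1 else 0)
  (λ u v → cong (λ b → if b then 1 else 0) (sym G u v))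
  (λ u → cong (λ b → if b then 1 else 0) (irrefl G u))

factor : ∀ {n x} {G : SimpleGraph n} → EdgeDecomposition G x → Fin x → SimpleGraph n
factor {G = G} D k = record
  { adj    = λ u v → adj G u v ∧ ⌊ col D u v ≟ k ⌋
  ; sym    = factor-sym
  ; irrefl = λ u → cong (_∧ _) (irrefl G u)
  }
  where
  factor-sym : ∀ u v → adj G u v ∧ ⌊ col D u v ≟ k ⌋ ≡ adj G v u ∧ ⌊ col D v u ≟ k ⌋
  factor-sym u v with adj G u v in uv
  ... | false rewrite trans (sym G v u) uv = refl
  ... | true  rewrite trans (sym G v u) uv | colSym D u v uv = refl

degree-sum-factorDegree : ∀ {n x} {G : SimpleGraph n} (D : EdgeDecomposition G x) v →
  sumFin x (λ k → factorDegree D k v) ≡ degree G v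
degree-sum-factorDegree {n} {x} {G} D v =
  trans (sumFin-swap x n (λ k u → if adj G v u ∧ ⌊ col D v u ≟ k ⌋ then 1 else 0))
        (sumFin-cong n λ u → trans (countFin-∧ˡ x (adj G v u) (λ k → ⌊ col D v u ≟ k ⌋))
                                   (cong (λ c → if adj G v u then c else 0) (countFin-≟ (col D v u))))

sumFin-tight : ∀ n (g : Fin n → ℕ) c → (∀ i → c ≤ g i) → sumFin n g ≡ n * c → ∀ i → g i ≡ c
sumFin-tight zero    g c c≤g sum≡ ()
sumFin-tight (suc n) g c c≤g sum≡ = tight
  where
  S = sumFin n (λ i → g (suc i))
  n*c≤S : n * c ≤ S
  n*c≤S = subst (_≤ S) (sumFin-const n c) (sumFin-mono n (λ i → c≤g (suc i)))
  g0≡c : g zero ≡ c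
  g0≡c = ≤-antisym (+-cancelʳ-≤ S (g zero) c (subst (_≤ c + S) (≡-sym sum≡) (+-monoʳ-≤ c n*c≤S)))
                   (c≤g zero)
  tight : ∀ i → g i ≡ c
  tight zero    = g0≡c
  tight (suc i) = sumFin-tight n (λ i → g (suc i)) c (λ i → c≤g (suc i))
    (+-cancelˡ-≡ c S (n * c) (trans (cong (_+ S) (≡-sym g0≡c)) sum≡)) i

sumFin-attains-bound : ∀ n (g : Fin n → ℕ) c → (∀ i → g i ≤ c) → n * c < sumFin n g + n →
  ∃ λ i → g i ≡ c
sumFin-attains-bound n g c g≤c n*c< with any? (λ i → g i ℕ.≟ c)
... | yes found = found
... | no  none  = contradiction n*c< (≤⇒≯ (begin
    sumFin n g + n                  ≡⟨ cong (sumFin n g +_) (sumFin-one n) ⟨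
    sumFin n g + sumFin n (λ _ → 1) ≡⟨ sumFin-+ n g (λ _ → 1) ⟨
    sumFin n (λ i → g i + 1)        ≤⟨ sumFin-mono n g<c ⟩
    sumFin n (λ _ → c)              ≡⟨ sumFin-const n c ⟩
    n * c                           ∎))
  where
  open ℕ.≤-Reasoning
  g<c : ∀ i → g i + 1 ≤ c
  g<c i = subst (_≤ c) (+-comm 1 (g i)) (≤∧≢⇒< (g≤c i) (λ gi≡c → none (i , gi≡c)))

factorization-parity : ∀ {n r a x} (G : SimpleGraph (suc n)) → RangeFactorization G r a x → 2 ∣ r →
  (∀ v → degree G (suc v) ≡ x * r) → x * (r + a) < degree G zero + x → 2 ∣ a
factorization-parity {n} {r} {a} {x} G F 2∣r deg-rest deg-hub = ∣m+n∣m⇒∣n 2∣r+a 2∣r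
  where
  open RangeFactorization F
  factor-regular : ∀ k v → factorDegree decomp k (suc v) ≡ r
  factor-regular k v = sumFin-tight x (λ k → factorDegree decomp k (suc v)) r (λ k → proj₁ (degOK k (suc v)))
    (trans (degree-sum-factorDegree decomp (suc v)) (deg-rest v)) k
  full : ∃ λ k → factorDegree decomp k zero ≡ r + a
  full = sumFin-attains-bound x (λ k → factorDegree decomp k zero) (r + a) (λ k → proj₂ (degOK k zero))
    (subst (λ d → x * (r + a) < d + x) (≡-sym (degree-sum-factorDegree decomp zero)) deg-hub)
  k = proj₁ full
  2∣r+a+n*r : 2 ∣ (r + a) + n * r
  2∣r+a+n*r = subst (2 ∣_)
    (cong₂ _+_ (proj₂ full) (trans (sumFin-cong n (factor-regular k)) (sumFin-const n r)))
    (degree-sum-even (factor decomp k))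
  2∣r+a : 2 ∣ r + a
  2∣r+a = ∣m+n∣m⇒∣n (subst (2 ∣_) (+-comm (r + a) (n * r)) 2∣r+a+n*r) (∣n⇒∣m*n n 2∣r)

cliqueMinusEdge : ∀ {k} → Fin (2 + k) → Fin (2 + k) → Bool
cliqueMinusEdge zero          zero          = false
cliqueMinusEdge zero          (suc zero)    = false
cliqueMinusEdge zero          (suc (suc j)) = true
cliqueMinusEdge (suc zero)    zero          = false
cliqueMinusEdge (suc zero)    (suc zero)    = false
cliqueMinusEdge (suc zero)    (suc (suc j)) = true
cliqueMinusEdge (suc (suc i)) zero          = true
cliqueMinusEdge (suc (suc i)) (suc zero)    = true
cliqueMinusEdge (suc (suc i)) (suc (suc j)) = not ⌊ i ≟ j ⌋

cliqueMinusEdge-sym : ∀ {k} (i j : Fin (2 + k)) → cliqueMinusEdge i j ≡ cliqueMinusEdge j i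
cliqueMinusEdge-sym zero          zero          = refl
cliqueMinusEdge-sym zero          (suc zero)    = refl
cliqueMinusEdge-sym zero          (suc (suc j)) = refl
cliqueMinusEdge-sym (suc zero)    zero          = refl
cliqueMinusEdge-sym (suc zero)    (suc zero)    = refl
cliqueMinusEdge-sym (suc zero)    (suc (suc j)) = refl
cliqueMinusEdge-sym (suc (suc i)) zero          = refl
cliqueMinusEdge-sym (suc (suc i)) (suc zero)    = refl
cliqueMinusEdge-sym (suc (suc i)) (suc (suc j)) = cong not (⌊≟⌋-sym i j)

cliqueMinusEdge-irrefl : ∀ {k} (i : Fin (2 + k)) → cliqueMinusEdge i i ≡ false
cliqueMinusEdge-irrefl zero          = refl
cliqueMinusEdge-irrefl (suc zero)    = refl
cliqueMinusEdge-irrefl (suc (suc i)) = cong not (⌊≟⌋-refl i)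

missingEdgeEnd : ∀ {k} → Fin (2 + k) → Bool
missingEdgeEnd zero          = true
missingEdgeEnd (suc zero)    = true
missingEdgeEnd (suc (suc _)) = false

countFin-missingEdgeEnd : ∀ k → countFin (2 + k) missingEdgeEnd ≡ 2
countFin-missingEdgeEnd k = cong (λ c → 1 + (1 + c)) (sumFin-zero k)

-- Joining the two ends of the missing edge to an outside vertex restores degree k + 1 everywhere.
cliqueMinusEdge-degree : ∀ {k} (i : Fin (2 + k)) →
  (if missingEdgeEnd i then 1 else 0) + countFin (2 + k) (cliqueMinusEdge i) ≡ suc k
cliqueMinusEdge-degree {k} zero          = cong suc (sumFin-one k)
cliqueMinusEdge-degree {k} (suc zero)    = cong suc (sumFin-one k)
cliqueMinusEdge-degree {k} (suc (suc i)) = cong suc (countFin-≢ i)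

module HubOfCopies (m k : ℕ) where

  copy : Fin (m * (2 + k)) → Fin m
  copy v = proj₁ (remQuot {m} (2 + k) v)

  position : Fin (m * (2 + k)) → Fin (2 + k)
  position v = proj₂ (remQuot {m} (2 + k) v)

  hubAdj : Fin (suc (m * (2 + k))) → Fin (suc (m * (2 + k))) → Bool
  hubAdj zero    zero    = false
  hubAdj zero    (suc v) = missingEdgeEnd (position v)
  hubAdj (suc u) zero    = missingEdgeEnd (position u)
  hubAdj (suc u) (suc v) = ⌊ copy u ≟ copy v ⌋ ∧ cliqueMinusEdge (position u) (position v)

  hubAdj-sym : ∀ u v → hubAdj u v ≡ hubAdj v u
  hubAdj-sym zero    zero    = refl
  hubAdj-sym zero    (suc v) = refl
  hubAdj-sym (suc u) zero    = refl
  hubAdj-sym (suc u) (suc v) =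
    cong₂ _∧_ (⌊≟⌋-sym (copy u) (copy v)) (cliqueMinusEdge-sym (position u) (position v))

  hubAdj-irrefl : ∀ u → hubAdj u u ≡ false
  hubAdj-irrefl zero    = refl
  hubAdj-irrefl (suc u) =
    trans (cong (⌊ copy u ≟ copy u ⌋ ∧_) (cliqueMinusEdge-irrefl (position u))) (∧-zeroʳ _)

  hubGraph : SimpleGraph (suc (m * (2 + k)))
  hubGraph = record { adj = hubAdj ; sym = hubAdj-sym ; irrefl = hubAdj-irrefl }

  degree-hub : degree hubGraph zero ≡ m * 2
  degree-hub = begin
    countFin (m * (2 + k)) (λ v → missingEdgeEnd (position v))
      ≡⟨ sumFin-remQuot m (2 + k) (λ (_ , j) → if missingEdgeEnd j then 1 else 0) ⟩
    sumFin m (λ _ → countFin (2 + k) missingEdgeEnd)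
      ≡⟨ sumFin-cong m (λ _ → countFin-missingEdgeEnd k) ⟩
    sumFin m (λ _ → 2)
      ≡⟨ sumFin-const m 2 ⟩
    m * 2 ∎
    where open ≡-Reasoning

  degree-copy : ∀ v → degree hubGraph (suc v) ≡ suc k
  degree-copy v = begin
    toHub + countFin (m * (2 + k)) (λ u → ⌊ i ≟ copy u ⌋ ∧ cliqueMinusEdge c (position u))
      ≡⟨ cong (toHub +_)
              (sumFin-remQuot m (2 + k) (λ (i′ , j) → if ⌊ i ≟ i′ ⌋ ∧ cliqueMinusEdge c j then 1 else 0)) ⟩
    toHub + sumFin m (λ i′ → countFin (2 + k) (λ j → ⌊ i ≟ i′ ⌋ ∧ cliqueMinusEdge c j))
      ≡⟨ cong (toHub +_) (sumFin-cong m (λ i′ → countFin-∧ˡ (2 + k) ⌊ i ≟ i′ ⌋ (cliqueMinusEdge c))) ⟩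
    toHub + sumFin m (λ i′ → if ⌊ i ≟ i′ ⌋ then countFin (2 + k) (cliqueMinusEdge c) else 0)
      ≡⟨ cong (toHub +_) (sumFin-indicator i (countFin (2 + k) (cliqueMinusEdge c))) ⟩
    toHub + countFin (2 + k) (cliqueMinusEdge c)
      ≡⟨ cliqueMinusEdge-degree c ⟩
    suc k ∎
    where
    open ≡-Reasoning
    i = copy v
    c = position v
    toHub = if missingEdgeEnd c then 1 else 0

⌊n/2⌋*2≤n : ∀ n → ⌊ n /2⌋ * 2 ≤ n
⌊n/2⌋*2≤n zero          = z≤n
⌊n/2⌋*2≤n (suc zero)    = z≤n
⌊n/2⌋*2≤n (suc (suc n)) = s≤s (s≤s (⌊n/2⌋*2≤n n))

n≤1+⌊n/2⌋*2 : ∀ n → n ≤ suc (⌊ n /2⌋ * 2)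
n≤1+⌊n/2⌋*2 zero          = z≤n
n≤1+⌊n/2⌋*2 (suc zero)    = s≤s z≤n
n≤1+⌊n/2⌋*2 (suc (suc n)) = s≤s (s≤s (n≤1+⌊n/2⌋*2 n))

-- Besides the parities of r and a, only d ≥ 1, s ≥ 1 and x ≥ 2 are used.
theorem30 : (r a d s x : ℕ) →
    2 ≤ r → 2 ∣ r → 3 ≤ a → ¬ (2 ∣ a) →
    1 ≤ d → 1 ≤ s → 1 ≤ x →
    d + s ≡ x * (r + a) → d ≡ x * r → 2 ≤ x → a < d * r →
    Σ ℕ (λ n → Σ (SimpleGraph n) (λ G → IsRangeGraph G d s × ¬ RangeFactorization G r a x))
theorem30 r a (suc k) s x _ 2∣r _ a-odd _ 1≤s _ d+s≡ d≡ 2≤x _ =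
  suc (m * (2 + k)) , hubGraph , range ,
  λ F → a-odd (factorization-parity hubGraph F 2∣r (λ v → trans (degree-copy v) d≡) hub-large)
  where
  T = x * (r + a)
  m = ⌊ T /2⌋
  open HubOfCopies m k
  T≤1+2m : T ≤ suc (m * 2)
  T≤1+2m = n≤1+⌊n/2⌋*2 T
  range : IsRangeGraph hubGraph (suc k) s
  range zero    = subst (λ δ → suc k ≤ δ × δ ≤ suc k + s) (≡-sym degree-hub)
    ( ℕ.≤-pred (≤-trans (subst (suc k <_) d+s≡ (m<m+n (suc k) 1≤s)) T≤1+2m)
    , subst (m * 2 ≤_) (≡-sym d+s≡) (⌊n/2⌋*2≤n T) )
  range (suc v) = subst (λ δ → suc k ≤ δ × δ ≤ suc k + s) (≡-sym (degree-copy v)) (≤-refl , m≤m+n (suc k) s)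
  hub-large : T < degree hubGraph zero + x
  hub-large = subst (λ δ → T < δ + x) (≡-sym degree-hub)
    (≤-<-trans (subst (T ≤_) (+-comm 1 (m * 2)) T≤1+2m) (+-monoʳ-< (m * 2) 2≤x))
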